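{- Let $n\ge 2$. Let $\mathcal{G}_n^{[0,2]}$ be the set of GDAP of length $n$ all of whose vertices have ordinate in $\{0,1,2\}$, and let $\mathcal{C}(n-2)$ be the set of compositions of $n-2$ (ordered sequences of positive integers summing to $n-2$) in which no two consecutive parts have the same parity. Define $\psi:\mathcal{G}_n^{[0,2]}\to\mathcal{C}(n-2)$ as follows. For $\alpha=\alpha_1\alpha_2\cdots\alpha_n\in\mathcal{G}_n^{[0,2]}$ (written as a word of steps), let $\alpha'=\alpha_2\alpha_3\cdots\alpha_{n-1}$. If $\alpha'$ contains neither the factor $UU$ nor the factor $UD_2$, set $r=1$ and $B_1=\alpha'$; otherwise, write $\alpha'=B_1B_2\cdots B_r$ by cutting $\alpha'$ immediately after each up-step of $\alpha'$ that is followed (in $\alpha'$) by another up-step or by a $D_2$-step. Let $b_i$ be the length of $B_i$ and set $\psi(\alpha)=(b_1,b_2,\dots,b_r)$ (when $\alpha'$ is empty, i.e. $\alpha=UD$, $\psi(\alpha)$ is the empty composition of $0$). Then $\psi$ is a bijection from $\mathcal{G}_n^{[0,2]}$ onto $\mathcal{C}(n-2)$.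
   Context: A grand Dyck path with air pockets (GDAP) is a lattice path in $\mathbb{Z}^2$ starting at $(0,0)$ and ending on the $x$-axis, consisting of up-steps $U=(1,1)$ and down-steps $D_k=(1,-k)$ with $k\ge 1$, such that no two down-steps are consecutive; the empty path is a GDAP. The length of a path is its number of steps; $D$ denotes $D_1$. -}

module Defs where

open import Data.Nat using (ℕ; zero; suc; _≤_; _%_; _∸_)
open import Data.Integer using (ℤ; +_; -_; _+_) renaming (_≤_ to _≤ℤ_)
open import Data.List using (List; []; _∷_; length; map; inits; foldr)
open import Data.Nat.ListAction using (sum)
open import Data.List.Relation.Unary.All using (All)
open import Data.List.Relation.Unary.Linked using (Linked)
open import Data.Product using (_×_; Σ; ∃-syntax)
open import Data.Bool using (Bool; true; false; if_then_else_)
open import Relation.Binary.PropositionalEquality using (_≡_)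
open import Relation.Nullary using (¬_)

-- Steps: U = (1,1), D k = (1,-k).  A GDAP requires k ≥ 1 (see ValidStep).
data Step : Set where
  U : Step
  D : ℕ → Step

disp : Step → ℤ
disp U     = + 1
disp (D k) = - (+ k)

height : List Step → ℤ
height = foldr (λ s h → disp s + h) (+ 0)

data ValidStep : Step → Set where
  vU : ValidStep U
  vD : ∀ {k} → 1 ≤ k → ValidStep (D k)

data IsDown : Step → Set where
  isD : ∀ {k} → IsDown (D k)

record IsGDAP (α : List Step) : Set where
  field
    steps-valid : All ValidStep α
    no-DD       : Linked (λ s t → ¬ (IsDown s × IsDown t)) α
    ends-at-0   : height α ≡ + 0

InStrip : List Step → Set
InStrip α = All (λ h → (+ 0 ≤ℤ h) × (h ≤ℤ + 2)) (map height (inits α))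

G02 : ℕ → List Step → Set
G02 n α = IsGDAP α × InStrip α × (length α ≡ n)

Comp : ℕ → List ℕ → Set
Comp m c = All (λ b → 1 ≤ b) c × (sum c ≡ m) × Linked (λ a b → ¬ (a % 2 ≡ b % 2)) c

dropLast : List Step → List Step
dropLast []           = []
dropLast (x ∷ [])     = []
dropLast (x ∷ y ∷ ys) = x ∷ dropLast (y ∷ ys)

middle : List Step → List Step
middle []       = []
middle (_ ∷ xs) = dropLast xs

cutFollower : Step → Bool
cutFollower U                   = true
cutFollower (D (suc (suc zero))) = true
cutFollower (D _)               = false

-- lengths of the blocks, c = length of the current (unfinished) block
blocksFrom : ℕ → List Step → List ℕ
blocksFrom c []               = c ∷ []
blocksFrom c (U ∷ y ∷ ys)     =
  if cutFollower y then suc c ∷ blocksFrom 0 (y ∷ ys) else blocksFrom (suc c) (y ∷ ys)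
blocksFrom c (x ∷ ys)         = blocksFrom (suc c) ys

blocks : List Step → List ℕ
blocks []         = []
blocks xs@(_ ∷ _) = blocksFrom 0 xs

ψ : List Step → List ℕ
ψ α = blocks (middle α)

{-# OPTIONS --safe #-}
-- Apart from its first step U and its last step back to the axis, a path in 𝒢ₙ^[0,2]
-- is a sequence of moves: a dip DU at level 1 or 2, a rise U from level 1 to level 2,
-- or a fall D₂U from level 2 to level 1.  The cuts of ψ sit exactly before the rises
-- and falls (except a rise as the very first move), so every block is a rise (length 1),
-- a fall or an initial dip (length 2), followed by dips of length 2.  Blocks at level 2
-- are therefore odd and blocks at level 1 even, and as the levels alternate so do the
-- parities.  Conversely the parity of a part fixes the level of its block and its size
-- the number of dips, which recovers the path.
module Submission where

open import Defs
open import Data.Nat using (ℕ; _≤_; _∸_)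
open import Data.List using (List)
open import Data.Product using (_×_; ∃-syntax)
open import Relation.Binary.PropositionalEquality using (_≡_)

open import Data.Nat using (suc; _+_; _%_; z≤n; s≤s)
open import Data.Nat.Properties using (+-suc; suc-injective; ≤-refl; ≤-trans; m≤n+m; n≤1+n; 1+n≰n; m+[n∸m]≡n)
open import Data.Integer as ℤ using (ℤ; +_; -[1+_]; +≤+) renaming (_≤_ to _≤ℤ_)
import Data.Integer.Properties as ℤ
open import Data.List using ([]; _∷_; length; map; inits)
open import Data.Nat.ListAction using (sum)
open import Data.List.Relation.Unary.All as All using (All; []; _∷_)
import Data.List.Relation.Unary.All.Properties as All
open import Data.List.Relation.Unary.Linked as Linked using (Linked; []; [-]; _∷_)
open import Data.Product as Product using (∃; ∃₂; _,_)
open import Data.Empty using (⊥-elim)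
open import Function using (_∘_)
open import Relation.Binary.PropositionalEquality using (refl; sym; trans; cong; subst)
open import Relation.Nullary using (¬_)

-- Strip walks

InRange : ℤ → Set
InRange h = (+ 0 ≤ℤ h) × (h ≤ℤ + 2)

0∈range : InRange (+ 0)
0∈range = +≤+ z≤n , +≤+ z≤n

1∈range : InRange (+ 1)
1∈range = +≤+ z≤n , +≤+ (s≤s z≤n)

2∈range : InRange (+ 2)
2∈range = +≤+ z≤n , +≤+ (s≤s (s≤s z≤n))

InRangeFrom : ℤ → List Step → Set
InRangeFrom o α = All (λ h → InRange (o ℤ.+ h)) (map height (inits α))

NoDD : Step → Step → Set
NoDD s t = ¬ (IsDown s × IsDown t)

inRangeFrom-∷⁻ : ∀ o x α → InRangeFrom o (x ∷ α) → InRange o × InRangeFrom (o ℤ.+ disp x) α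
inRangeFrom-∷⁻ o x α (r ∷ rs) =
  subst InRange (ℤ.+-identityʳ o) r ,
  All.map⁺
    (All.map (λ {p} → subst InRange (sym (ℤ.+-assoc o (disp x) (height p))))
             (All.map⁻ (All.map⁻ {xs = map (x ∷_) (inits α)} rs)))

inRangeFrom-∷⁺ : ∀ o x α → InRange o → InRangeFrom (o ℤ.+ disp x) α → InRangeFrom o (x ∷ α)
inRangeFrom-∷⁺ o x α r rs =
  subst InRange (sym (ℤ.+-identityʳ o)) r ∷
  All.map⁺ (All.map⁺ {xs = inits α}
    (All.map (λ {p} → subst InRange (ℤ.+-assoc o (disp x) (height p)))
             (All.map⁻ {xs = inits α} rs)))

-- StripWalk o s α: α runs from ordinate o back to the x-axis inside the strip
-- 0 ≤ y ≤ 2, and s is the step before α, only relevant to forbid DD.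
data StripWalk : ℤ → Step → List Step → Set where
  done : ∀ {s} → StripWalk (+ 0) s []
  up   : ∀ {o s α} → InRange o → StripWalk (o ℤ.+ disp U) U α → StripWalk o s (U ∷ α)
  down : ∀ {o m α} → InRange o → 1 ≤ m → StripWalk (o ℤ.+ disp (D m)) (D m) α →
         StripWalk o U (D m ∷ α)

StripPath : ℤ → Step → List Step → Set
StripPath o s α =
  All ValidStep α × Linked NoDD (s ∷ α) × (o ℤ.+ height α ≡ + 0) × InRangeFrom o α

height-∷ : ∀ o x α → o ℤ.+ height (x ∷ α) ≡ (o ℤ.+ disp x) ℤ.+ height α
height-∷ o x α = sym (ℤ.+-assoc o (disp x) (height α))

stripWalk⇒stripPath : ∀ {o s α} → StripWalk o s α → StripPath o s α
stripWalk⇒stripPath done = [] , [-] , refl , 0∈range ∷ []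
stripWalk⇒stripPath {o} {s} {x ∷ α} (up r w) with stripWalk⇒stripPath w
... | valid , noDD , ends , inRange =
  vU ∷ valid , (λ ()) ∷ noDD , trans (height-∷ o x α) ends , inRangeFrom-∷⁺ o x α r inRange
stripWalk⇒stripPath {o} {s} {x ∷ α} (down r 1≤k w) with stripWalk⇒stripPath w
... | valid , noDD , ends , inRange =
  vD 1≤k ∷ valid , (λ ()) ∷ noDD , trans (height-∷ o x α) ends , inRangeFrom-∷⁺ o x α r inRange

stripPath⇒stripWalk : ∀ o s α → StripPath o s α → StripWalk o s α
stripPath⇒stripWalk o s [] (_ , _ , ends , _) =
  subst (λ o → StripWalk o s []) (trans (sym ends) (ℤ.+-identityʳ o)) done
stripPath⇒stripWalk o s (U ∷ α) (vU ∷ valid , _ ∷ noDD , ends , inRange)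
  with inRangeFrom-∷⁻ o U α inRange
... | r , rs = up r (stripPath⇒stripWalk _ U α (valid , noDD , trans (sym (height-∷ o U α)) ends , rs))
stripPath⇒stripWalk o U (D k ∷ α) (vD 1≤k ∷ valid , _ ∷ noDD , ends , inRange)
  with inRangeFrom-∷⁻ o (D k) α inRange
... | r , rs =
  down r 1≤k (stripPath⇒stripWalk _ (D k) α (valid , noDD , trans (sym (height-∷ o (D k) α)) ends , rs))
stripPath⇒stripWalk o (D j) (D k ∷ α) (_ , DD ∷ _ , _) = ⊥-elim (DD (isD , isD))

U∷-noDD : ∀ {α} → Linked NoDD α → Linked NoDD (U ∷ α)
U∷-noDD {[]}    _    = [-]
U∷-noDD {_ ∷ _} noDD = (λ ()) ∷ noDD

G02⇒stripWalk : ∀ {n α} → G02 n α → StripWalk (+ 0) U α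
G02⇒stripWalk {α = α} (gdap , inStrip , _) =
  stripPath⇒stripWalk (+ 0) U α
    ( steps-valid
    , U∷-noDD no-DD
    , trans (ℤ.+-identityˡ (height α)) ends-at-0
    , All.map (λ {h} → subst InRange (sym (ℤ.+-identityˡ h))) inStrip )
  where open IsGDAP gdap

stripWalk⇒GDAP : ∀ {α} → StripWalk (+ 0) U α → IsGDAP α × InStrip α
stripWalk⇒GDAP {α} w with stripWalk⇒stripPath w
... | valid , noDD , ends , inRange =
  record { steps-valid = valid
         ; no-DD       = Linked.tail noDD
         ; ends-at-0   = trans (sym (ℤ.+-identityˡ (height α))) ends }
  , All.map (λ {h} → subst InRange (ℤ.+-identityˡ h)) inRange

stripWalk-nonneg : ∀ {j s α} → ¬ StripWalk -[1+ j ] s α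
stripWalk-nonneg (up (() , _) _)
stripWalk-nonneg (down (() , _) _ _)

stripWalk-≤2 : ∀ {s α} → ¬ StripWalk (+ 3) s α
stripWalk-≤2 (up (_ , +≤+ (s≤s (s≤s ()))) _)
stripWalk-≤2 (down (_ , +≤+ (s≤s (s≤s ()))) _ _)

-- Block decompositions

data Level : Set where
  one two : Level

level : Level → ℕ
level one = 1
level two = 2

-- Tail ℓ k xs cs: xs finishes a strip walk that has just reached level ℓ by an up-step,
-- the current block has length k including that up-step, and cs are the lengths of the
-- blocks from the current one on.  The last step of the path is not part of α′, hence
-- `end` does not count it.
data Tail : Level → ℕ → List Step → List ℕ → Set where
  end  : ∀ {ℓ k} → Tail ℓ k (D (level ℓ) ∷ []) (k ∷ [])
  dip  : ∀ {ℓ k ys cs} → Tail ℓ (2 + k) ys cs → Tail ℓ k (D 1 ∷ U ∷ ys) cs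
  rise : ∀ {k ys cs} → Tail two 1 ys cs → Tail one k (U ∷ ys) (k ∷ cs)
  fall : ∀ {k ys cs} → Tail one 2 ys cs → Tail two k (D 2 ∷ U ∷ ys) (k ∷ cs)

-- Middle xs cs is Tail one 0, except that the first step of the path is not part of
-- α′, so a cut right after it yields no block.
data Middle : List Step → List ℕ → Set where
  end  : Middle (D 1 ∷ []) []
  dip  : ∀ {ys cs} → Tail one 2 ys cs → Middle (D 1 ∷ U ∷ ys) cs
  rise : ∀ {ys cs} → Tail two 1 ys cs → Middle (U ∷ ys) cs

tail⇒stripWalk : ∀ {ℓ k xs cs} → Tail ℓ k xs cs → StripWalk (+ level ℓ) U xs
tail⇒stripWalk {one} end     = down 1∈range (s≤s z≤n) done
tail⇒stripWalk {two} end     = down 2∈range (s≤s z≤n) done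
tail⇒stripWalk {one} (dip t) = down 1∈range (s≤s z≤n) (up 0∈range (tail⇒stripWalk t))
tail⇒stripWalk {two} (dip t) = down 2∈range (s≤s z≤n) (up 1∈range (tail⇒stripWalk t))
tail⇒stripWalk (rise t)      = up 1∈range (tail⇒stripWalk t)
tail⇒stripWalk (fall t)      = down 2∈range (s≤s z≤n) (up 0∈range (tail⇒stripWalk t))

middle⇒stripWalk : ∀ {xs cs} → Middle xs cs → StripWalk (+ 1) U xs
middle⇒stripWalk end      = down 1∈range (s≤s z≤n) done
middle⇒stripWalk (dip t)  = down 1∈range (s≤s z≤n) (up 0∈range (tail⇒stripWalk t))
middle⇒stripWalk (rise t) = up 1∈range (tail⇒stripWalk t)

parseTail : ∀ ℓ k {xs} → StripWalk (+ level ℓ) U xs → ∃ (Tail ℓ k xs)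
parseTail one k (up _ w)                           = Product.map (k ∷_) rise (parseTail two 1 w)
parseTail ℓ   k (down {m = 0} _ () _)
parseTail one k (down {m = 1} _ _ done)            = _ , end
parseTail one k (down {m = 1} _ _ (up _ w))        = Product.map₂ dip (parseTail one (2 + k) w)
parseTail one k (down {m = suc (suc _)} _ _ w)     = ⊥-elim (stripWalk-nonneg w)
parseTail two k (up _ w)                           = ⊥-elim (stripWalk-≤2 w)
parseTail two k (down {m = 1} _ _ (up _ w))        = Product.map₂ dip (parseTail two (2 + k) w)
parseTail two k (down {m = 2} _ _ done)            = _ , end
parseTail two k (down {m = 2} _ _ (up _ w))        = Product.map (k ∷_) fall (parseTail one 2 w)
parseTail two k (down {m = suc (suc (suc _))} _ _ w) = ⊥-elim (stripWalk-nonneg w)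

parseMiddle : ∀ {xs} → StripWalk (+ 1) U xs → ∃ (Middle xs)
parseMiddle (down {m = 0} _ () _)
parseMiddle (up _ w)                       = Product.map₂ rise (parseTail two 1 w)
parseMiddle (down {m = 1} _ _ done)        = _ , end
parseMiddle (down {m = 1} _ _ (up _ w))    = Product.map₂ dip (parseTail one 2 w)
parseMiddle (down {m = suc (suc _)} _ _ w) = ⊥-elim (stripWalk-nonneg w)

dropLast-∷ : ∀ {ℓ k xs cs} → Tail ℓ k xs cs → ∀ x → dropLast (x ∷ xs) ≡ x ∷ dropLast xs
dropLast-∷ end      _ = refl
dropLast-∷ (dip _)  _ = refl
dropLast-∷ (rise _) _ = refl
dropLast-∷ (fall _) _ = refl

-- blocksFrom j counts the current block without its pending up-step.
tail-blocks : ∀ {ℓ j xs cs} → Tail ℓ (suc j) xs cs → blocksFrom j (U ∷ dropLast xs) ≡ cs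
tail-blocks end = refl
tail-blocks {j = j} (dip t) =
  trans (cong (blocksFrom (2 + j)) (dropLast-∷ t U)) (tail-blocks t)
tail-blocks {j = j} (rise t) =
  trans (cong (blocksFrom j ∘ (U ∷_)) (dropLast-∷ t U)) (cong (suc j ∷_) (tail-blocks t))
tail-blocks {j = j} (fall t) =
  trans (cong (blocksFrom j ∘ (U ∷_) ∘ (D 2 ∷_)) (dropLast-∷ t U)) (cong (suc j ∷_) (tail-blocks t))

middle-ψ : ∀ {xs cs} → Middle xs cs → ψ (U ∷ xs) ≡ cs
middle-ψ end      = refl
middle-ψ (dip t)  = trans (cong (blocksFrom 1) (dropLast-∷ t U)) (tail-blocks t)
middle-ψ (rise t) = trans (cong blocks (dropLast-∷ t U)) (tail-blocks t)

tail-length : ∀ {ℓ k xs cs} → Tail ℓ k xs cs → k + length xs ≡ suc (sum cs)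
tail-length {k = k} end = +-suc k 0
tail-length {k = k} {D 1 ∷ U ∷ ys} (dip t) =
  trans (+-suc k (suc (length ys))) (trans (cong suc (+-suc k (length ys))) (tail-length t))
tail-length {k = k} {U ∷ ys} (rise t) =
  trans (+-suc k (length ys)) (cong (λ m → suc (k + m)) (suc-injective (tail-length t)))
tail-length {k = k} {D 2 ∷ U ∷ ys} (fall t) =
  trans (+-suc k (suc (length ys))) (cong (λ m → suc (k + m)) (suc-injective (tail-length t)))

middle-length : ∀ {xs cs} → Middle xs cs → length xs ≡ suc (sum cs)
middle-length end      = refl
middle-length (dip t)  = tail-length t
middle-length (rise t) = tail-length t

-- Parities of blocks

infix 4 _≤₂_

data _≤₂_ : ℕ → ℕ → Set where
  ≤₂-refl : ∀ {m} → m ≤₂ m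
  ≤₂-step : ∀ {m n} → 2 + m ≤₂ n → m ≤₂ n

≤₂-+2 : ∀ {m n} → m ≤₂ n → m ≤₂ 2 + n
≤₂-+2 ≤₂-refl      = ≤₂-step ≤₂-refl
≤₂-+2 (≤₂-step le) = ≤₂-step (≤₂-+2 le)

≤₂⇒≤ : ∀ {m n} → m ≤₂ n → m ≤ n
≤₂⇒≤ {m} ≤₂-refl      = ≤-refl
≤₂⇒≤ {m} (≤₂-step le) = ≤-trans (m≤n+m m 2) (≤₂⇒≤ le)

≤₂⇒%2≡ : ∀ {m n} → m ≤₂ n → n % 2 ≡ m % 2
≤₂⇒%2≡ ≤₂-refl      = refl
≤₂⇒%2≡ (≤₂-step le) = ≤₂⇒%2≡ le

DifferentParity : ℕ → ℕ → Set
DifferentParity a b = ¬ (a % 2 ≡ b % 2)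

parity : Level → ℕ
parity one = 0
parity two = 1

other : Level → Level
other one = two
other two = one

parityLevel : ∀ h → ∃[ ℓ ] h % 2 ≡ parity ℓ
parityLevel 0             = one , refl
parityLevel 1             = two , refl
parityLevel (suc (suc h)) = parityLevel h

differentParity : ∀ ℓ a b → a % 2 ≡ parity ℓ → b % 2 ≡ parity (other ℓ) → DifferentParity a b
differentParity one _ _ a≡ b≡ a≡b with () ← trans (sym a≡) (trans a≡b b≡)
differentParity two _ _ a≡ b≡ a≡b with () ← trans (sym a≡) (trans a≡b b≡)

differentParity⇒other : ∀ ℓ a b → a % 2 ≡ parity ℓ → DifferentParity a b → b % 2 ≡ parity (other ℓ)
differentParity⇒other ℓ a b a≡ a≢b with parityLevel b
differentParity⇒other one a b a≡ a≢b | two , b≡ = b≡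
differentParity⇒other two a b a≡ a≢b | one , b≡ = b≡
differentParity⇒other one a b a≡ a≢b | one , b≡ = ⊥-elim (a≢b (trans a≡ (sym b≡)))
differentParity⇒other two a b a≡ a≢b | two , b≡ = ⊥-elim (a≢b (trans a≡ (sym b≡)))

-- A block starting at level one begins with the D₂U of a fall, one starting at
-- level two with the U of a rise.
blockStart : Level → ℕ
blockStart one = 2
blockStart two = 1

blockStart≤₂ : ∀ ℓ h → 1 ≤ h → h % 2 ≡ parity ℓ → blockStart ℓ ≤₂ h
blockStart≤₂ one 1 _ ()
blockStart≤₂ one 2 _ _                   = ≤₂-refl
blockStart≤₂ two 1 _ _                   = ≤₂-refl
blockStart≤₂ two 2 _ ()
blockStart≤₂ ℓ (suc (suc (suc h))) _ h≡ = ≤₂-+2 (blockStart≤₂ ℓ (suc h) (s≤s z≤n) h≡)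

tail-head : ∀ {ℓ k xs cs} → Tail ℓ k xs cs → ∃₂ λ h t → cs ≡ h ∷ t × k ≤₂ h
tail-head end      = _ , _ , refl , ≤₂-refl
tail-head (dip t)  = Product.map₂ (Product.map₂ (Product.map₂ ≤₂-step)) (tail-head t)
tail-head (rise _) = _ , _ , refl , ≤₂-refl
tail-head (fall _) = _ , _ , refl , ≤₂-refl

tail-nonempty : ∀ {ℓ k xs} → ¬ Tail ℓ k xs []
tail-nonempty t with tail-head t
... | _ , _ , () , _

¬tail-headBelow : ∀ {ℓ k xs cs} → ¬ Tail ℓ (2 + k) xs (k ∷ cs)
¬tail-headBelow {k = k} t with tail-head t
... | _ , _ , refl , le = 1+n≰n (≤-trans (n≤1+n (suc k)) (≤₂⇒≤ le))

tail-positive : ∀ {ℓ k xs cs} → 1 ≤ k → Tail ℓ k xs cs → All (1 ≤_) cs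
tail-positive 1≤k end      = 1≤k ∷ []
tail-positive 1≤k (dip t)  = tail-positive (≤-trans 1≤k (m≤n+m _ 2)) t
tail-positive 1≤k (rise t) = 1≤k ∷ tail-positive (s≤s z≤n) t
tail-positive 1≤k (fall t) = 1≤k ∷ tail-positive (s≤s z≤n) t

tail-differentParity : ∀ {ℓ k xs cs} → Tail ℓ k xs cs → k % 2 ≡ parity ℓ → Linked DifferentParity cs
tail-differentParity end     _   = [-]
tail-differentParity (dip t) k≡  = tail-differentParity t k≡
tail-differentParity {k = k} (rise t) k≡ with tail-head t
... | h , _ , refl , le = differentParity one k h k≡ (≤₂⇒%2≡ le) ∷ tail-differentParity t refl
tail-differentParity {k = k} (fall t) k≡ with tail-head t
... | h , _ , refl , le = differentParity two k h k≡ (≤₂⇒%2≡ le) ∷ tail-differentParity t refl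

middle-comp : ∀ {xs cs} → Middle xs cs → Comp (length xs ∸ 1) cs
middle-comp m = positive m , cong (_∸ 1) (sym (middle-length m)) , alternating m
  where
  positive : ∀ {xs cs} → Middle xs cs → All (1 ≤_) cs
  positive end      = []
  positive (dip t)  = tail-positive (s≤s z≤n) t
  positive (rise t) = tail-positive (s≤s z≤n) t

  alternating : ∀ {xs cs} → Middle xs cs → Linked DifferentParity cs
  alternating end      = []
  alternating (dip t)  = tail-differentParity t refl
  alternating (rise t) = tail-differentParity t refl

tail-injective : ∀ {ℓ k xs ys cs} → Tail ℓ k xs cs → Tail ℓ k ys cs → xs ≡ ys
tail-injective end      end      = refl
tail-injective (dip s)  (dip t)  = cong (λ zs → D 1 ∷ U ∷ zs) (tail-injective s t)
tail-injective (rise s) (rise t) = cong (U ∷_) (tail-injective s t)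
tail-injective (fall s) (fall t) = cong (λ zs → D 2 ∷ U ∷ zs) (tail-injective s t)
tail-injective end      (dip t)  = ⊥-elim (¬tail-headBelow t)
tail-injective (dip s)  end      = ⊥-elim (¬tail-headBelow s)
tail-injective (dip s)  (rise _) = ⊥-elim (¬tail-headBelow s)
tail-injective (dip s)  (fall _) = ⊥-elim (¬tail-headBelow s)
tail-injective (rise _) (dip t)  = ⊥-elim (¬tail-headBelow t)
tail-injective (fall _) (dip t)  = ⊥-elim (¬tail-headBelow t)
tail-injective end      (rise t) = ⊥-elim (tail-nonempty t)
tail-injective end      (fall t) = ⊥-elim (tail-nonempty t)
tail-injective (rise s) end      = ⊥-elim (tail-nonempty s)
tail-injective (fall s) end      = ⊥-elim (tail-nonempty s)

middle-injective : ∀ {xs ys cs} → Middle xs cs → Middle ys cs → xs ≡ ys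
middle-injective end      end      = refl
middle-injective (dip s)  (dip t)  = cong (λ zs → D 1 ∷ U ∷ zs) (tail-injective s t)
middle-injective (rise s) (rise t) = cong (U ∷_) (tail-injective s t)
middle-injective end      (dip t)  = ⊥-elim (tail-nonempty t)
middle-injective end      (rise t) = ⊥-elim (tail-nonempty t)
middle-injective (dip s)  end      = ⊥-elim (tail-nonempty s)
middle-injective (rise s) end      = ⊥-elim (tail-nonempty s)
middle-injective (dip s)  (rise t) with tail-head s | tail-head t
... | _ , _ , refl , 2≤₂h | _ , _ , refl , 1≤₂h with () ← trans (sym (≤₂⇒%2≡ 2≤₂h)) (≤₂⇒%2≡ 1≤₂h)
middle-injective (rise s) (dip t)  with tail-head s | tail-head t
... | _ , _ , refl , 1≤₂h | _ , _ , refl , 2≤₂h with () ← trans (sym (≤₂⇒%2≡ 2≤₂h)) (≤₂⇒%2≡ 1≤₂h)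

tail-exists : ∀ ℓ {k h} cs → k ≤₂ h → h % 2 ≡ parity ℓ → All (1 ≤_) cs →
              Linked DifferentParity (h ∷ cs) → ∃[ xs ] Tail ℓ k xs (h ∷ cs)
tail-exists ℓ cs (≤₂-step le) h≡ pos alt = Product.map _ dip (tail-exists ℓ cs le h≡ pos alt)
tail-exists ℓ [] ≤₂-refl _ _ _ = _ , end
tail-exists one {h = h} (c ∷ cs) ≤₂-refl h≡ (1≤c ∷ pos) (h≢c ∷ alt) =
  Product.map _ rise (tail-exists two cs (blockStart≤₂ two c 1≤c c≡) c≡ pos alt)
  where
  c≡ : c % 2 ≡ parity two
  c≡ = differentParity⇒other one h c h≡ h≢c
tail-exists two {h = h} (c ∷ cs) ≤₂-refl h≡ (1≤c ∷ pos) (h≢c ∷ alt) =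
  Product.map _ fall (tail-exists one cs (blockStart≤₂ one c 1≤c c≡) c≡ pos alt)
  where
  c≡ : c % 2 ≡ parity one
  c≡ = differentParity⇒other two h c h≡ h≢c

middle-exists : ∀ cs → All (1 ≤_) cs → Linked DifferentParity cs → ∃[ xs ] Middle xs cs
middle-exists []       _           _   = _ , end
middle-exists (h ∷ cs) (1≤h ∷ pos) alt with parityLevel h
... | one , h≡ = Product.map _ dip  (tail-exists one cs (blockStart≤₂ one h 1≤h h≡) h≡ pos alt)
... | two , h≡ = Product.map _ rise (tail-exists two cs (blockStart≤₂ two h 1≤h h≡) h≡ pos alt)

G02⇒middle : ∀ {n α} → G02 n α → 1 ≤ n → ∃[ xs ] α ≡ U ∷ xs × Middle xs (ψ α)
G02⇒middle {α = []} (_ , _ , refl) ()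
G02⇒middle {α = U ∷ xs} g _ with G02⇒stripWalk g
... | up _ w with parseMiddle w
...   | _ , m = xs , refl , subst (Middle xs) (sym (middle-ψ m)) m
G02⇒middle {α = D _ ∷ _} g _ with G02⇒stripWalk g
... | down {m = 0}     _ () _
... | down {m = suc _} _ _  w = ⊥-elim (stripWalk-nonneg w)

middle⇒G02 : ∀ {xs cs} → Middle xs cs → G02 (2 + sum cs) (U ∷ xs)
middle⇒G02 m with stripWalk⇒GDAP (up 0∈range (middle⇒stripWalk m))
... | gdap , inStrip = gdap , inStrip , cong suc (middle-length m)

theorem5 : (n : ℕ) → 2 ≤ n →
    ((α : List Step) → G02 n α → Comp (n ∸ 2) (ψ α))
    × ((α β : List Step) → G02 n α → G02 n β → ψ α ≡ ψ β → α ≡ β)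
    × ((c : List ℕ) → Comp (n ∸ 2) c → ∃[ α ] (G02 n α × ψ α ≡ c))
theorem5 n 2≤n = composition , injective , surjective
  where
  1≤n : 1 ≤ n
  1≤n = ≤-trans (s≤s z≤n) 2≤n

  composition : (α : List Step) → G02 n α → Comp (n ∸ 2) (ψ α)
  composition α g@(_ , _ , length≡n) with G02⇒middle g 1≤n
  ... | _ , refl , m = subst (λ l → Comp (l ∸ 2) (ψ α)) length≡n (middle-comp m)

  injective : (α β : List Step) → G02 n α → G02 n β → ψ α ≡ ψ β → α ≡ β
  injective α β gα gβ ψα≡ψβ with G02⇒middle gα 1≤n | G02⇒middle gβ 1≤n
  ... | _ , refl , mα | _ , refl , mβ =
    cong (U ∷_) (middle-injective mα (subst (Middle _) (sym ψα≡ψβ) mβ))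

  surjective : (c : List ℕ) → Comp (n ∸ 2) c → ∃[ α ] (G02 n α × ψ α ≡ c)
  surjective c (positive , sum≡ , alternating) with middle-exists c positive alternating
  ... | xs , m =
    U ∷ xs ,
    subst (λ l → G02 l (U ∷ xs)) (trans (cong (λ s → 2 + s) sum≡) (m+[n∸m]≡n 2≤n)) (middle⇒G02 m) ,
    middle-ψ m
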